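{- Let $G$ be an $\alpha$-erased graph with average degree $\overline{d}$, let $\varepsilon \in (0,2/\overline{d})$ and $\alpha \in [0,\varepsilon)$. If $G$ is $\varepsilon$-far from connected, then the number of $(\varepsilon - \alpha)$-small generalized witnesses to disconnectedness of $G$ is at least $(\varepsilon - \alpha) m/2$.
   Context: Graphs are simple and undirected, on a vertex set $V$ with $n=|V|$, represented by adjacency lists; $\mathrm{adj}(u)$ denotes the adjacency list of $u$. For $\alpha\in[0,1]$, an $\alpha$-erased graph is the concatenation of the adjacency lists of a simple undirected graph $(V,E)$ in which at most $2\alpha|E|$ entries have been replaced by a special symbol $\bot$ (erased). A completion of $G$ is the adjacency-list representation of a simple undirected graph on $V$ that coincides with $G$ on all nonerased entries (list lengths unchanged). $m$ is half the total length of all adjacency lists and $\overline{d}=2m/n$. $G$ is $\varepsilon$-far from connected if every completion differs in at least $\varepsilon m$ edges from every connected graph. A set $C\subset V$ is a generalized witness to disconnectedness of $G$ if (1) there is at most one $\bot$ in $\bigcup_{v\in C}\mathrm{adj}(v)$; (2) every nonerased entry of $\bigcup_{v\in C}\mathrm{adj}(v)$ is a vertex of $C$; (3) if $\bot\in\mathrm{adj}(u)$ for some $u\in C$, then there is $v\in C$ with $u\in\mathrm{adj}(v)$ but $v\notin\mathrm{adj}(u)$, and every vertex of $C$ is reachable via a BFS (along nonerased entries) from $v$. For $\varepsilon^\star\in(0,2/\overline{d})$, the representation length of $C$ is the sum of the lengths of the adjacency lists of its vertices; $C$ is $\varepsilon^\star$-small if either $\varepsilon^\star\ge 4/\overline{d}^2$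 and $|C|\le 4/(\varepsilon^\star\overline{d})$, or $\varepsilon^\star<4/\overline{d}^2$ and $C$ has representation length at most $4/\varepsilon^\star$.
   Formalization: The parameters ε and α, as well as the parameter $\varepsilon^\star$ in the definition of smallness, take rational values. -}

module Defs where

open import Data.Nat as ℕ using (ℕ; zero; suc)
open import Data.Integer using (+_)
open import Data.Rational using (ℚ; _/_; 0ℚ)
open import Data.Bool using (Bool; true; false; if_then_else_; _xor_; _∧_)
open import Data.Fin using (Fin; toℕ)
open import Data.Fin.Properties using () renaming (_≟_ to _≟ᶠ_)
open import Data.Fin.Subset using (Subset; _∈_; _∉_; Nonempty; ∣_∣)
open import Data.Maybe using (Maybe; just; nothing)
open import Data.List using (List; []; _∷_; length; map; allFin)
open import Data.Nat.ListAction using (sum)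
open import Data.List.Membership.Propositional using () renaming (_∈_ to _∈ˡ_)
import Data.List.Membership.DecPropositional as DecMem
open import Data.List.Relation.Unary.Unique.Propositional using (Unique)
open import Data.List.Relation.Binary.Pointwise using (Pointwise)
open import Data.Vec using (lookup)
open import Data.Product using (Σ; _×_; ∃)
open import Data.Sum using (_⊎_)
open import Relation.Nullary using (¬_; does)
open import Relation.Binary.PropositionalEquality using (_≡_)

Σᵥ : ∀ {n} → (Fin n → ℕ) → ℕ
Σᵥ {n} f = sum (map f (allFin n))

ℕtoℚ : ℕ → ℚ
ℕtoℚ k = + k / 1

AdjList : ℕ → Set
AdjList n = Fin n → List (Fin n)

-- adjacency lists with possibly erased entries (nothing = ⊥)
ErasedAdj : ℕ → Set
ErasedAdj n = Fin n → List (Maybe (Fin n))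

IsSimple : ∀ {n} → AdjList n → Set
IsSimple {n} H =
  (∀ v → Unique (H v)) ×
  (∀ v → ¬ (v ∈ˡ H v)) ×
  (∀ u v → v ∈ˡ H u → u ∈ˡ H v)

-- total length of all adjacency lists (= 2m)
totalLen : ∀ {n} → ErasedAdj n → ℕ
totalLen G = Σᵥ (λ v → length (G v))

mOf : ∀ {n} → ErasedAdj n → ℚ
mOf G = + totalLen G / 2

avgDeg : ∀ {n} → ErasedAdj n → ℚ
avgDeg {zero} G = 0ℚ
avgDeg {suc n} G = + totalLen G / suc n

count⊥ : ∀ {n} → List (Maybe (Fin n)) → ℕ
count⊥ [] = 0
count⊥ (nothing ∷ xs) = suc (count⊥ xs)
count⊥ (just _ ∷ xs) = count⊥ xs

total⊥ : ∀ {n} → ErasedAdj n → ℕ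
total⊥ G = Σᵥ (λ v → count⊥ (G v))

Agrees : ∀ {n} → Maybe (Fin n) → Fin n → Set
Agrees e x = (e ≡ nothing) ⊎ (e ≡ just x)

Coincides : ∀ {n} → ErasedAdj n → AdjList n → Set
Coincides G H = ∀ v → Pointwise Agrees (G v) (H v)

-- G is an α-erased graph: obtained from the representation of a simple
-- graph (V,E) by erasing at most 2α|E| entries (2|E| = totalLen G)
IsAlphaErased : ∀ {n} → ℚ → ErasedAdj n → Set
IsAlphaErased α G = Σ _ λ H → IsSimple H × Coincides G H ×
  (Data.Rational._≤_ (ℕtoℚ (total⊥ G)) (Data.Rational._*_ α (ℕtoℚ (totalLen G))))

IsCompletion : ∀ {n} → ErasedAdj n → AdjList n → Set
IsCompletion G H = IsSimple H × Coincides G H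

data Reach {n} (R : Fin n → Fin n → Set) (u : Fin n) : Fin n → Set where
  here : Reach R u u
  step : ∀ {v w} → Reach R u v → R v w → Reach R u w

IsConnected : ∀ {n} → AdjList n → Set
IsConnected H = IsSimple H × (∀ u v → Reach (λ a b → b ∈ˡ H a) u v)

mem : ∀ {n} → Fin n → List (Fin n) → Bool
mem {n} v xs = does (DecMem._∈?_ (_≟ᶠ_ {n}) v xs)

edgeDiff : ∀ {n} → AdjList n → AdjList n → ℕ
edgeDiff H K = Σᵥ λ u → Σᵥ λ v →
  if (does (toℕ u ℕ.<? toℕ v)) ∧ (mem v (H u) xor mem v (K u))
  then 1 else 0

IsFarFromConnected : ∀ {n} → ℚ → ErasedAdj n → Set
IsFarFromConnected ε G = ∀ H K → IsCompletion G H → IsConnected K →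
  Data.Rational._≤_ (Data.Rational._*_ ε (mOf G)) (ℕtoℚ (edgeDiff H K))

⊥In : ∀ {n} → ErasedAdj n → Subset n → ℕ
⊥In G C = Σᵥ λ v → if lookup C v then count⊥ (G v) else 0

repLen : ∀ {n} → ErasedAdj n → Subset n → ℕ
repLen G C = Σᵥ λ v → if lookup C v then length (G v) else 0

ReachG : ∀ {n} → ErasedAdj n → Fin n → Fin n → Set
ReachG G = Reach (λ a b → just b ∈ˡ G a)

record GenWitness {n} (G : ErasedAdj n) (C : Subset n) : Set where
  field
    nonempty : Nonempty C
    proper   : ∃ λ v → v ∉ C
    at-most-one-⊥ : ⊥In G C ℕ.≤ 1
    closed   : ∀ v w → v ∈ C → just w ∈ˡ G v → w ∈ C
    erased   : ∀ u → u ∈ C → nothing ∈ˡ G u →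
      Σ (Fin n) λ v → v ∈ C × just u ∈ˡ G v × ¬ (just v ∈ˡ G u) ×
        (∀ w → w ∈ C → ReachG G v w)

-- ε*-small, with divisions cleared (all denominators positive in the
-- respective branches):  ε* ≥ 4/d̄²  ⇔  4 ≤ ε*·d̄²,
-- |C| ≤ 4/(ε* d̄)  ⇔  |C|·ε*·d̄ ≤ 4,  repLen ≤ 4/ε*  ⇔  repLen·ε* ≤ 4
IsSmall : ∀ {n} → ℚ → ErasedAdj n → Subset n → Set
IsSmall ε* G C =
  (ℕtoℚ 4 ≤ ε* * d * d × ℕtoℚ ∣ C ∣ * ε* * d ≤ ℕtoℚ 4) ⊎
  (ε* * d * d < ℕtoℚ 4 × ℕtoℚ (repLen G C) * ε* ≤ ℕtoℚ 4)
  where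
  open Data.Rational using (_≤_; _<_; _*_)
  d = avgDeg G

module Submission where

-- Let H be the simple graph from which G arose by erasures, and label every vertex by the
-- least vertex of its H-component. Joining vertex 0 to the least vertex of each of the other
-- ρ components makes H connected at the cost of ρ edges, so ε m ≤ ρ. A component is a
-- generalized witness as soon as its adjacency lists carry at most one erasure: an erased
-- entry u → x is the reverse of an intact entry x → u, and an H-path from x can only use an
-- erased step by returning to x. Of the ρ + 1 components, at most α m carry two or more of
-- the at most 2α m erasures, and at most (ε − α) m / 2 fail to be (ε − α)-small, because
-- their sizes add up to n (and n d̄ = 2m) and their representation lengths add up to 2m.
-- This leaves at least ε m − α m − (ε − α) m / 2 = (ε − α) m / 2 small witnesses.

module FiniteSum where

  open import Defs using (Σᵥ)
  open import Data.Nat using (ℕ; zero; suc; _+_; _*_; _≤_; _<_; z≤n)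
  open import Data.Nat.Properties hiding (_≟_)
  open import Data.Fin using (Fin; zero; suc)
  open import Data.Fin.Properties using (_≟_)
  open import Data.Bool using (Bool; true; false; T; if_then_else_)
  open import Data.List using (map; tabulate)
  open import Data.List.Properties using (map-tabulate)
  import Data.Nat.ListAction as List
  open import Function using (_∘_; id)
  open import Relation.Nullary using (¬_; yes; no; does; contradiction)
  open import Relation.Binary.PropositionalEquality

  open import Algebra.Properties.Semiring.Sum +-*-semiring public
    using (sum; sum-syntax; sum-cong-≗; ∑-distrib-+; ∑-comm; *-distribˡ-sum)

  indicator : Bool → ℕ
  indicator b = if b then 1 else 0

  indicator-≤ : ∀ b {x} → (T b → 1 ≤ x) → indicator b ≤ x
  indicator-≤ true  1≤x = 1≤x _
  indicator-≤ false 1≤x = z≤n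

  Σᵥ≡sum : ∀ {n} (f : Fin n → ℕ) → Σᵥ f ≡ sum f
  Σᵥ≡sum f = trans (cong List.sum (map-tabulate id f)) (sum-tabulate f)
    where
    sum-tabulate : ∀ {n} (f : Fin n → ℕ) → List.sum (tabulate f) ≡ sum f
    sum-tabulate {zero}  f = refl
    sum-tabulate {suc n} f = cong (f zero +_) (sum-tabulate (f ∘ suc))

  sum-zero : ∀ {n} (f : Fin n → ℕ) → (∀ i → f i ≡ 0) → sum f ≡ 0
  sum-zero {zero}  f f≡0 = refl
  sum-zero {suc n} f f≡0 = cong₂ _+_ (f≡0 zero) (sum-zero (f ∘ suc) (f≡0 ∘ suc))

  sum-const : ∀ n x → ∑[ i < n ] x ≡ n * x
  sum-const zero    x = refl
  sum-const (suc n) x = cong (x +_) (sum-const n x)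

  sum-mono-≤ : ∀ {n} {f g : Fin n → ℕ} → (∀ i → f i ≤ g i) → sum f ≤ sum g
  sum-mono-≤ {zero}  f≤g = z≤n
  sum-mono-≤ {suc n} f≤g = +-mono-≤ (f≤g zero) (sum-mono-≤ (f≤g ∘ suc))

  sum-mono-< : ∀ {n} {f g : Fin n → ℕ} → (∀ i → f i ≤ g i) → ∀ j → f j < g j → sum f < sum g
  sum-mono-< f≤g zero    fj<gj = +-mono-<-≤ fj<gj (sum-mono-≤ (f≤g ∘ suc))
  sum-mono-< f≤g (suc j) fj<gj = +-mono-≤-< (f≤g zero) (sum-mono-< (f≤g ∘ suc) j fj<gj)

  term≤sum : ∀ {n} (f : Fin n → ℕ) i → f i ≤ sum f
  term≤sum f zero    = m≤m+n _ _
  term≤sum f (suc i) = ≤-trans (term≤sum (f ∘ suc) i) (m≤n+m _ _)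

  two-terms≤sum : ∀ {n} (f : Fin n → ℕ) {i j} → ¬ i ≡ j → f i + f j ≤ sum f
  two-terms≤sum f {zero}  {zero}  i≢j = contradiction refl i≢j
  two-terms≤sum f {zero}  {suc j} i≢j = +-monoʳ-≤ (f zero) (term≤sum (f ∘ suc) j)
  two-terms≤sum f {suc i} {zero}  i≢j =
    ≤-trans (≤-reflexive (+-comm (f (suc i)) (f zero))) (+-monoʳ-≤ (f zero) (term≤sum (f ∘ suc) i))
  two-terms≤sum f {suc i} {suc j} i≢j = ≤-trans (two-terms≤sum (f ∘ suc) (i≢j ∘ cong suc)) (m≤n+m _ _)

  sum-δ : ∀ {n} (i : Fin n) (x : ℕ) → ∑[ j < n ] (if does (i ≟ j) then x else 0) ≡ x
  sum-δ {suc n} zero    x = trans (cong (x +_) (sum-zero {n} _ λ _ → refl)) (+-identityʳ x)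
  sum-δ {suc n} (suc i) x = trans (sum-cong-≗ {n} δ-suc) (sum-δ i x)
    where
    δ-suc : ∀ j → (if does (suc i ≟ suc j) then x else 0) ≡ (if does (i ≟ j) then x else 0)
    δ-suc j with i ≟ j
    ... | yes _ = refl
    ... | no  _ = refl

module ListProperties where

  open FiniteSum using (indicator)
  open import Data.Nat using (suc)
  open import Data.Bool using (true; false)
  open import Data.List using (List; []; _∷_; map; filter; length)
  import Data.Nat.ListAction as List
  open import Data.List.Relation.Unary.All as All using (All; []; _∷_)
  import Data.List.Relation.Unary.All.Properties as Allₚ
  open import Data.List.Relation.Unary.AllPairs using ([]; _∷_)
  open import Data.List.Relation.Unary.Unique.Propositional using (Unique)
  open import Function using (_∘_)
  open import Relation.Nullary using (does)
  open import Relation.Unary using (Decidable)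
  open import Relation.Binary.PropositionalEquality

  length-filter≡sum : ∀ {A : Set} {P : A → Set} (P? : Decidable P) xs →
                      length (filter P? xs) ≡ List.sum (map (indicator ∘ does ∘ P?) xs)
  length-filter≡sum P? []       = refl
  length-filter≡sum P? (x ∷ xs) with does (P? x)
  ... | true  = cong suc (length-filter≡sum P? xs)
  ... | false = length-filter≡sum P? xs

  Unique-map⁺-on : ∀ {A B : Set} {P : A → Set} (f : A → B) → (∀ {x y} → P x → f x ≡ f y → x ≡ y) →
                   ∀ {xs} → All P xs → Unique xs → Unique (map f xs)
  Unique-map⁺-on f inj []         []            = []
  Unique-map⁺-on f inj (px ∷ pxs) (x∉xs ∷ uniq) =
    Allₚ.map⁺ (All.map (λ x≢y fx≡fy → x≢y (inj px fx≡fy)) x∉xs) ∷ Unique-map⁺-on f inj pxs uniq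

module Components where

  open FiniteSum using (sum; sum-mono-<)
  open import Defs using (AdjList; Reach; here; step)
  open import Data.Nat using (ℕ; zero; suc; _≤_; _<_)
  open import Data.Nat.Properties using (≤-refl; ≤-trans; ≤-pred; ≤-antisym; ≤∧≢⇒<; n≤0⇒n≡0)
  open import Data.Fin using (Fin; toℕ)
  open import Data.Fin.Properties using (_≟_; toℕ-injective; all?; ¬∀⟶∃¬)
  open import Data.List.Membership.Propositional using (_∈_)
  import Data.List.Relation.Unary.All as All
  open import Data.List.Extrema.Nat using (argmin; argmin-sel; f[argmin]≤f[⊤]; f[argmin]≤f[xs])
  open import Data.Product using (_×_; _,_; proj₁; proj₂)
  open import Data.Sum using (inj₁; inj₂)
  open import Function using (_∘_; id)
  open import Relation.Nullary using (¬_; Dec; yes; no)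
  open import Relation.Binary.PropositionalEquality

  Edge : ∀ {n} → AdjList n → Fin n → Fin n → Set
  Edge H u v = v ∈ H u

  Symmetric : ∀ {n} → AdjList n → Set
  Symmetric H = ∀ {u v} → v ∈ H u → u ∈ H v

  module _ {n} {R : Fin n → Fin n → Set} where

    Reach-trans : ∀ {u v w} → Reach R u v → Reach R v w → Reach R u w
    Reach-trans p here       = p
    Reach-trans p (step q r) = step (Reach-trans p q) r

    Reach-map : ∀ {R′ : Fin n → Fin n → Set} → (∀ {u v} → R u v → R′ u v) →
                ∀ {u v} → Reach R u v → Reach R′ u v
    Reach-map f here       = here
    Reach-map f (step p r) = step (Reach-map f p) (f r)

  Reach-sym : ∀ {n} {H : AdjList n} → Symmetric H → ∀ {u v} → Reach (Edge H) u v → Reach (Edge H) v u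
  Reach-sym symH here       = here
  Reach-sym symH (step p r) = Reach-trans (step here (symH r)) (Reach-sym symH p)

  record ComponentLabelling {n} (H : AdjList n) : Set where
    field
      label       : Fin n → Fin n
      reach-label : ∀ v → Reach (Edge H) v (label v)
      label-≤     : ∀ v → toℕ (label v) ≤ toℕ v
      label-edge  : ∀ {v w} → w ∈ H v → label v ≡ label w

    label-reach : ∀ {v w} → Reach (Edge H) v w → label v ≡ label w
    label-reach here       = refl
    label-reach (step p r) = trans (label-reach p) (label-edge r)

    label-idem : ∀ v → label (label v) ≡ label v
    label-idem v = sym (label-reach (reach-label v))

    label-first : ∀ {z} → toℕ z ≡ 0 → label z ≡ z
    label-first {z} z≡0 =
      toℕ-injective (trans (n≤0⇒n≡0 (subst (toℕ (label z) ≤_) z≡0 (label-≤ z))) (sym z≡0))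

    same-label⇒reach : Symmetric H → ∀ {v w} → label v ≡ label w → Reach (Edge H) v w
    same-label⇒reach symH {v} {w} eq = Reach-trans (reach-label v)
      (subst (λ x → Reach (Edge H) x w) (sym eq) (Reach-sym symH (reach-label w)))

  -- Until the labelling is stable, the sum of the label indices strictly decreases,
  -- so that sum plus one rounds suffice.
  module MinPropagation {n} (H : AdjList n) where

    relax : (Fin n → Fin n) → Fin n → Fin n
    relax f v = f (argmin (toℕ ∘ f) v (H v))

    Descending : (Fin n → Fin n) → Set
    Descending f = ∀ v → Reach (Edge H) v (f v) × toℕ (f v) ≤ toℕ v

    Stable : (Fin n → Fin n) → Set
    Stable f = ∀ v → relax f v ≡ f v

    stable? : ∀ f → Dec (Stable f)
    stable? f = all? (λ v → relax f v ≟ f v)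

    potential : (Fin n → Fin n) → ℕ
    potential f = sum (toℕ ∘ f)

    relax-≤ : ∀ f v → toℕ (relax f v) ≤ toℕ (f v)
    relax-≤ f v = f[argmin]≤f[⊤] {f = toℕ ∘ f} v (H v)

    stable-edge : ∀ {f} → Stable f → ∀ {v w} → w ∈ H v → toℕ (f v) ≤ toℕ (f w)
    stable-edge {f} st {v} {w} w∈Hv =
      subst (λ x → toℕ x ≤ toℕ (f w)) (st v) (All.lookup (f[argmin]≤f[xs] {f = toℕ ∘ f} v (H v)) w∈Hv)

    relax-descending : ∀ {f} → Descending f → Descending (relax f)
    relax-descending {f} desc v with argmin-sel (toℕ ∘ f) v (H v)
    ... | inj₁ a≡v  = subst (λ a → Reach (Edge H) v (f a)) (sym a≡v) (proj₁ (desc v)) , relax-below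
      where relax-below = ≤-trans (relax-≤ f v) (proj₂ (desc v))
    ... | inj₂ a∈Hv = Reach-trans (step here a∈Hv) (proj₁ (desc _)) , relax-below
      where relax-below = ≤-trans (relax-≤ f v) (proj₂ (desc v))

    relax-potential : ∀ f → ¬ Stable f → potential (relax f) < potential f
    relax-potential f unstable with ¬∀⟶∃¬ n _ (λ v → relax f v ≟ f v) unstable
    ... | v , changed = sum-mono-< (relax-≤ f) v (≤∧≢⇒< (relax-≤ f v) (changed ∘ toℕ-injective))

    stabilise : ℕ → (Fin n → Fin n) → Fin n → Fin n
    stabilise zero    f = f
    stabilise (suc k) f with stable? f
    ... | yes _ = f
    ... | no  _ = stabilise k (relax f)

    stabilise-descending : ∀ k {f} → Descending f → Descending (stabilise k f)
    stabilise-descending zero        desc = desc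
    stabilise-descending (suc k) {f} desc with stable? f
    ... | yes _ = desc
    ... | no  _ = stabilise-descending k (relax-descending desc)

    stabilise-stable : ∀ k f → potential f < k → Stable (stabilise k f)
    stabilise-stable (suc k) f p<k with stable? f
    ... | yes stable   = stable
    ... | no  unstable = stabilise-stable k (relax f) (≤-trans (relax-potential f unstable) (≤-pred p<k))

  -- Opaque, so that comparing types never runs the propagation.
  opaque
    componentLabelling : ∀ {n} (H : AdjList n) → Symmetric H → ComponentLabelling H
    componentLabelling {n} H symH = record
      { label       = label
      ; reach-label = proj₁ ∘ descending
      ; label-≤     = proj₂ ∘ descending
      ; label-edge  = λ w∈Hv →
          toℕ-injective (≤-antisym (stable-edge stable w∈Hv) (stable-edge stable (symH w∈Hv)))
      }
      where
      open MinPropagation H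
      rounds : ℕ
      rounds = suc (potential id)
      label : Fin n → Fin n
      label = stabilise rounds id
      descending : Descending label
      descending = stabilise-descending rounds (λ v → here , ≤-refl)
      stable : Stable label
      stable = stabilise-stable rounds id ≤-refl

module Connecting where

  open FiniteSum
  open Components
  open import Defs using (Σᵥ; AdjList; IsSimple; IsConnected; Reach; step; edgeDiff; mem)
  open import Data.Nat using (ℕ; zero; suc; _+_; _≤_; _<_; _<?_; z≤n; s≤s)
  open import Data.Nat.Properties using (+-identityʳ; <ᵇ⇒<; module ≤-Reasoning)
  open import Data.Fin using (Fin; zero; suc; toℕ)
  open import Data.Fin.Properties using (_≟_; suc-injective)
  open import Data.Bool using (true; false; T; if_then_else_; _∧_; _xor_)
  open import Data.Bool.Properties using (T-∧)
  open import Data.List using (List; []; _∷_; _++_; filter; tabulate)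
  open import Data.List.Membership.Propositional using (_∈_)
  open import Data.List.Membership.Propositional.Properties
    using (∈-++⁺ˡ; ∈-++⁺ʳ; ∈-++⁻; ∈-filter⁺; ∈-filter⁻; ∈-tabulate⁺; ∈-tabulate⁻)
  import Data.List.Membership.DecPropositional as DecMembership
  open import Data.List.Relation.Unary.Any using (here)
  import Data.List.Relation.Unary.All as All
  import Data.List.Relation.Unary.AllPairs as AllPairs
  open import Data.List.Relation.Unary.Unique.Propositional using (Unique)
  import Data.List.Relation.Unary.Unique.Propositional.Properties as Unique
  open import Data.Product using (∃; _×_; _,_; proj₁; proj₂)
  open import Data.Sum using (inj₁; inj₂)
  open import Data.Empty using (⊥-elim)
  open import Function using (_∘_)
  open import Function.Bundles using (module Equivalence)
  open import Relation.Nullary using (¬_; Dec; yes; no; does; contradiction)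
  open import Relation.Binary.PropositionalEquality

  _∈?_ : ∀ {n} (v : Fin n) xs → Dec (v ∈ xs)
  _∈?_ = DecMembership._∈?_ _≟_

  xor-∈?-++ : ∀ {n} (v : Fin n) xs ys → T (does (v ∈? xs) xor does (v ∈? (xs ++ ys))) → v ∈ ys
  xor-∈?-++ v xs ys differ with v ∈? xs | v ∈? (xs ++ ys)
  ... | yes _    | yes _        = ⊥-elim differ
  ... | no  _    | no  _        = ⊥-elim differ
  ... | yes v∈xs | no  v∉xs++ys = contradiction (∈-++⁺ˡ v∈xs) v∉xs++ys
  ... | no  v∉xs | yes v∈xs++ys with ∈-++⁻ xs v∈xs++ys
  ...   | inj₁ v∈xs = contradiction v∈xs v∉xs
  ...   | inj₂ v∈ys = v∈ys

  -- Joining the representative 0 of its component to the representative of every other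
  -- component adds one edge per further component and yields a connected simple graph K.
  module StarCompletion {n} (H : AdjList (suc n)) (simple : IsSimple H) where

    symH : Symmetric H
    symH {u} {v} = proj₂ (proj₂ simple) u v

    open ComponentLabelling (componentLabelling H symH) public

    IsRep : Fin (suc n) → Set
    IsRep v = label v ≡ v

    isRep? : ∀ v → Dec (IsRep v)
    isRep? v = label v ≟ v

    otherComponents : ℕ
    otherComponents = ∑[ i < n ] indicator (does (isRep? (suc i)))

    zero-isRep : IsRep zero
    zero-isRep = label-first refl

    reps-nonadjacent : ∀ {u v} → IsRep u → IsRep v → ¬ v ∈ H u
    reps-nonadjacent {u} {v} u-rep v-rep v∈Hu = proj₁ (proj₂ simple) v (subst (λ x → v ∈ H x) u≡v v∈Hu)
      where u≡v = trans (sym u-rep) (trans (label-edge v∈Hu) v-rep)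

    star : Fin (suc n) → List (Fin (suc n))
    star zero    = filter isRep? (tabulate suc)
    star (suc i) = if does (isRep? (suc i)) then zero ∷ [] else []

    K : AdjList (suc n)
    K v = H v ++ star v

    star-zero⁻ : ∀ {v} → v ∈ star zero → (∃ λ i → v ≡ suc i) × IsRep v
    star-zero⁻ v∈ with ∈-filter⁻ isRep? v∈
    ... | v∈tab , v-rep = ∈-tabulate⁻ v∈tab , v-rep

    star-zero⁺ : ∀ {i} → IsRep (suc i) → suc i ∈ star zero
    star-zero⁺ {i} = ∈-filter⁺ isRep? (∈-tabulate⁺ i)

    star-suc⁻ : ∀ {i v} → v ∈ star (suc i) → v ≡ zero × IsRep (suc i)
    star-suc⁻ {i} v∈ with isRep? (suc i)
    star-suc⁻ (here refl) | yes rep = refl , rep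

    star-suc⁺ : ∀ {i} → IsRep (suc i) → zero ∈ star (suc i)
    star-suc⁺ {i} rep with isRep? (suc i)
    ... | yes _    = here refl
    ... | no  ¬rep = contradiction rep ¬rep

    star-unique : ∀ v → Unique (star v)
    star-unique zero    = Unique.filter⁺ isRep? (Unique.tabulate⁺ suc-injective)
    star-unique (suc i) with does (isRep? (suc i))
    ... | true  = All.[] AllPairs.∷ AllPairs.[]
    ... | false = AllPairs.[]

    star-disjoint : ∀ {u v} → v ∈ H u → ¬ v ∈ star u
    star-disjoint {zero} v∈Hu v∈star with star-zero⁻ v∈star
    ... | _ , v-rep = reps-nonadjacent zero-isRep v-rep v∈Hu
    star-disjoint {suc i} v∈Hu v∈star with star-suc⁻ v∈star
    ... | refl , u-rep = reps-nonadjacent u-rep zero-isRep v∈Hu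

    star-irreflexive : ∀ v → ¬ v ∈ star v
    star-irreflexive zero v∈star with star-zero⁻ v∈star
    ... | (_ , ()) , _
    star-irreflexive (suc i) v∈star with star-suc⁻ v∈star
    ... | () , _

    star-symmetric : ∀ {u v} → v ∈ star u → u ∈ star v
    star-symmetric {zero} v∈star with star-zero⁻ v∈star
    ... | (_ , refl) , v-rep = star-suc⁺ v-rep
    star-symmetric {suc i} v∈star with star-suc⁻ v∈star
    ... | refl , u-rep = star-zero⁺ u-rep

    K-simple : IsSimple K
    K-simple = unique , irreflexive , symmetric
      where
      unique : ∀ v → Unique (K v)
      unique v = Unique.++⁺ (proj₁ simple v) (star-unique v) λ (w∈H , w∈star) → star-disjoint w∈H w∈star
      irreflexive : ∀ v → ¬ v ∈ K v
      irreflexive v v∈Kv with ∈-++⁻ (H v) v∈Kv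
      ... | inj₁ v∈Hv    = proj₁ (proj₂ simple) v v∈Hv
      ... | inj₂ v∈starv = star-irreflexive v v∈starv
      symmetric : ∀ u v → v ∈ K u → u ∈ K v
      symmetric u v v∈Ku with ∈-++⁻ (H u) v∈Ku
      ... | inj₁ v∈Hu    = ∈-++⁺ˡ (symH v∈Hu)
      ... | inj₂ v∈staru = ∈-++⁺ʳ (H v) (star-symmetric v∈staru)

    reach-zero : ∀ u → Reach (Edge K) u zero
    reach-zero u with label u in eq
    ... | zero  = subst (Reach (Edge K) u) eq (Reach-map ∈-++⁺ˡ (reach-label u))
    ... | suc i = step (subst (Reach (Edge K) u) eq (Reach-map ∈-++⁺ˡ (reach-label u)))
                       (∈-++⁺ʳ (H (suc i)) (star-suc⁺ (trans (cong label (sym eq)) (trans (label-idem u) eq))))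

    K-connected : IsConnected K
    K-connected = K-simple , λ u v →
      Reach-trans (reach-zero u) (Reach-sym (λ {a} {b} → proj₂ (proj₂ K-simple) a b) (reach-zero v))

    addedEdge : Fin (suc n) → Fin (suc n) → ℕ
    addedEdge zero (suc i) = indicator (does (isRep? (suc i)))
    addedEdge _    _       = 0

    changed : Fin (suc n) → Fin (suc n) → ℕ
    changed u v = if does (toℕ u <? toℕ v) ∧ (mem v (H u) xor mem v (K u)) then 1 else 0

    changed≤addedEdge : ∀ u v → changed u v ≤ addedEdge u v
    changed≤addedEdge u v = indicator-≤ _ λ u<v∧differ →
      let u<v , differ = Equivalence.to T-∧ u<v∧differ
      in added u v (<ᵇ⇒< (toℕ u) (toℕ v) u<v) (xor-∈?-++ v (H u) (star u) differ)
      where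
      added : ∀ u v → toℕ u < toℕ v → v ∈ star u → 1 ≤ addedEdge u v
      added zero v _ v∈star with star-zero⁻ v∈star
      ... | (i , refl) , rep with isRep? (suc i)
      ...   | yes _    = s≤s z≤n
      ...   | no  ¬rep = contradiction rep ¬rep
      added (suc i) v u<v v∈star with star-suc⁻ v∈star
      added (suc i) v () v∈star | refl , _

    edgeDiff≤otherComponents : edgeDiff H K ≤ otherComponents
    edgeDiff≤otherComponents = begin
      edgeDiff H K                                   ≡⟨ Σᵥ≡sum (Σᵥ ∘ changed) ⟩
      ∑[ u < suc n ] Σᵥ (changed u)                  ≡⟨ sum-cong-≗ (λ u → Σᵥ≡sum (changed u)) ⟩
      ∑[ u < suc n ] ∑[ v < suc n ] changed u v      ≤⟨ sum-mono-≤ (λ u → sum-mono-≤ (changed≤addedEdge u)) ⟩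
      ∑[ u < suc n ] ∑[ v < suc n ] addedEdge u v    ≡⟨ cong (otherComponents +_) none-from-nonzero ⟩
      otherComponents + 0                            ≡⟨ +-identityʳ _ ⟩
      otherComponents                                ∎
      where
      open ≤-Reasoning
      none-from-nonzero : ∑[ i < n ] ∑[ v < suc n ] addedEdge (suc i) v ≡ 0
      none-from-nonzero = sum-zero {n} _ λ i → sum-zero (addedEdge (suc i)) λ _ → refl

module Erasures where

  open import Defs using (Agrees; count⊥)
  open import Data.Nat using (ℕ; _≤_; z≤n; s≤s)
  open import Data.Nat.Properties using (≤-trans; n≤1+n)
  open import Data.Fin using (Fin)
  open import Data.Maybe using (Maybe; just; nothing)
  open import Data.List using (List; _∷_)
  open import Data.List.Membership.Propositional using (_∈_)
  open import Data.List.Relation.Unary.Any using (here; there)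
  open import Data.List.Relation.Unary.All using (lookup)
  open import Data.List.Relation.Unary.AllPairs using (_∷_)
  open import Data.List.Relation.Unary.Unique.Propositional using (Unique)
  open import Data.List.Relation.Binary.Pointwise using (Pointwise; _∷_)
  open import Data.Product using (∃; _,_)
  open import Data.Sum using (_⊎_; inj₁; inj₂)
  open import Relation.Nullary using (¬_; contradiction)
  open import Relation.Binary.PropositionalEquality

  data ErasedOver {n} : List (Maybe (Fin n)) → List (Fin n) → Fin n → Set where
    here  : ∀ {xs ys y} → ErasedOver (nothing ∷ xs) (y ∷ ys) y
    there : ∀ {e xs z ys y} → ErasedOver xs ys y → ErasedOver (e ∷ xs) (z ∷ ys) y

  module _ {n : ℕ} where

    erased⇒∈ : ∀ {xs ys} {y : Fin n} → ErasedOver xs ys y → y ∈ ys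
    erased⇒∈ here      = here refl
    erased⇒∈ (there e) = there (erased⇒∈ e)

    erased⇒count⊥ : ∀ {xs ys} {y : Fin n} → ErasedOver xs ys y → 1 ≤ count⊥ xs
    erased⇒count⊥ here                = s≤s z≤n
    erased⇒count⊥ (there {nothing} e) = ≤-trans (erased⇒count⊥ e) (n≤1+n _)
    erased⇒count⊥ (there {just _} e)  = erased⇒count⊥ e

    erased-unique : ∀ {xs ys} {y z : Fin n} → count⊥ xs ≤ 1 → ErasedOver xs ys y → ErasedOver xs ys z → y ≡ z
    erased-unique c≤1       here      here      = refl
    erased-unique (s≤s c≤0) here      (there e) = contradiction (≤-trans (erased⇒count⊥ e) c≤0) λ ()
    erased-unique (s≤s c≤0) (there e) here      = contradiction (≤-trans (erased⇒count⊥ e) c≤0) λ ()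
    erased-unique c≤1 (there {nothing} e) (there e′) = erased-unique (≤-trans (n≤1+n _) c≤1) e e′
    erased-unique c≤1 (there {just _}  e) (there e′) = erased-unique c≤1 e e′

    just∈⇒∈ : ∀ {xs ys} {w : Fin n} → Pointwise Agrees xs ys → just w ∈ xs → w ∈ ys
    just∈⇒∈ (inj₁ () ∷ _)   (here refl)
    just∈⇒∈ (inj₂ refl ∷ _) (here refl) = here refl
    just∈⇒∈ (_ ∷ agree)     (there w∈)  = there (just∈⇒∈ agree w∈)

    ∈⇒just∈⊎erased : ∀ {xs ys} {y : Fin n} → Pointwise Agrees xs ys → y ∈ ys →
                     just y ∈ xs ⊎ ErasedOver xs ys y
    ∈⇒just∈⊎erased (inj₁ refl ∷ _) (here refl) = inj₂ here
    ∈⇒just∈⊎erased (inj₂ refl ∷ _) (here refl) = inj₁ (here refl)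
    ∈⇒just∈⊎erased (_ ∷ agree)     (there y∈) with ∈⇒just∈⊎erased agree y∈
    ... | inj₁ y∈xs = inj₁ (there y∈xs)
    ... | inj₂ e    = inj₂ (there e)

    nothing∈⇒erased : ∀ {xs ys} → Pointwise Agrees xs ys → nothing ∈ xs → ∃ (ErasedOver {n} xs ys)
    nothing∈⇒erased (inj₁ refl ∷ _) (here refl) = _ , here
    nothing∈⇒erased (inj₂ () ∷ _)   (here refl)
    nothing∈⇒erased (_ ∷ agree)     (there ⊥∈) with nothing∈⇒erased agree ⊥∈
    ... | y , e = y , there e

    erased⇒just∉ : ∀ {xs ys} {y : Fin n} → Pointwise Agrees xs ys → Unique ys → ErasedOver xs ys y →
                   ¬ just y ∈ xs
    erased⇒just∉ (_ ∷ agree)     (y∉ys ∷ _) here      (there y∈) = lookup y∉ys (just∈⇒∈ agree y∈) refl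
    erased⇒just∉ (inj₁ () ∷ _)   _          (there e) (here refl)
    erased⇒just∉ (inj₂ refl ∷ _) (z∉ys ∷ _) (there e) (here refl) = lookup z∉ys (erased⇒∈ e) refl
    erased⇒just∉ (_ ∷ agree)     (_ ∷ uniq) (there e) (there y∈) = erased⇒just∉ agree uniq e y∈

module Fibres where

  open FiniteSum
  open import Defs using (Σᵥ)
  open import Data.Nat using (ℕ; suc; _+_; _*_; _≤_)
  open import Data.Nat.Properties using (≤-trans; ≤-reflexive; *-identityʳ)
  open import Data.Fin using (Fin)
  open import Data.Fin.Properties using (_≟_)
  open import Data.Fin.Subset using (Subset; _∈_; ∣_∣; inside; outside)
  open import Data.Bool using (true; if_then_else_)
  open import Data.Vec using ([]; _∷_; lookup; tabulate)
  open import Data.Vec.Properties using (lookup∘tabulate; []=⇒lookup; lookup⇒[]=)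
  open import Function using (_∘_)
  open import Relation.Nullary using (¬_; yes; does)
  open import Relation.Nullary.Decidable using (dec-true)
  open import Relation.Binary.PropositionalEquality

  fibre : ∀ {n m} → (Fin n → Fin m) → Fin m → Subset n
  fibre f r = tabulate (λ v → does (f v ≟ r))

  module _ {n m} (f : Fin n → Fin m) {r : Fin m} where

    lookup-fibre : ∀ v → lookup (fibre f r) v ≡ does (f v ≟ r)
    lookup-fibre = lookup∘tabulate (λ v → does (f v ≟ r))

    ∈-fibre⁺ : ∀ {v} → f v ≡ r → v ∈ fibre f r
    ∈-fibre⁺ {v} fv≡r = lookup⇒[]= v (fibre f r) (trans (lookup-fibre v) (dec-true (f v ≟ r) fv≡r))

    ∈-fibre⁻ : ∀ {v} → v ∈ fibre f r → f v ≡ r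
    ∈-fibre⁻ {v} v∈ = from-does (f v ≟ r) (trans (sym (lookup-fibre v)) ([]=⇒lookup v∈))
      where
      from-does : ∀ fv≟r → does fv≟r ≡ true → f v ≡ r
      from-does (yes fv≡r) _ = fv≡r

  sumOn : ∀ {n} → Subset n → (Fin n → ℕ) → ℕ
  sumOn {n} C h = ∑[ v < n ] (if lookup C v then h v else 0)

  Σᵥ≡sumOn : ∀ {n} (C : Subset n) h → Σᵥ (λ v → if lookup C v then h v else 0) ≡ sumOn C h
  Σᵥ≡sumOn C h = Σᵥ≡sum (λ v → if lookup C v then h v else 0)

  module _ {n} {C : Subset n} (h : Fin n → ℕ) where

    private
      on-member : ∀ {v} → v ∈ C → (if lookup C v then h v else 0) ≡ h v
      on-member v∈C rewrite []=⇒lookup v∈C = refl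

    term≤sumOn : ∀ {v} → v ∈ C → h v ≤ sumOn C h
    term≤sumOn {v} v∈C = ≤-trans (≤-reflexive (sym (on-member v∈C))) (term≤sum _ v)

    two-terms≤sumOn : ∀ {v w} → v ∈ C → w ∈ C → ¬ v ≡ w → h v + h w ≤ sumOn C h
    two-terms≤sumOn v∈C w∈C v≢w =
      ≤-trans (≤-reflexive (sym (cong₂ _+_ (on-member v∈C) (on-member w∈C)))) (two-terms≤sum _ v≢w)

  ∣∣≡sumOn : ∀ {n} (C : Subset n) → ∣ C ∣ ≡ sumOn C (λ _ → 1)
  ∣∣≡sumOn []            = refl
  ∣∣≡sumOn (inside  ∷ C) = cong suc (∣∣≡sumOn C)
  ∣∣≡sumOn (outside ∷ C) = ∣∣≡sumOn C

  sum-sumOn-fibres : ∀ {n m} (f : Fin n → Fin m) (h : Fin n → ℕ) → ∑[ r < m ] sumOn (fibre f r) h ≡ sum h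
  sum-sumOn-fibres {n} {m} f h = begin
    ∑[ r < m ] sumOn (fibre f r) h        ≡⟨ sum-cong-≗ (λ r → sum-cong-≗ (λ v →
                                               cong (if_then h v else 0) (lookup-fibre f {r} v))) ⟩
    ∑[ r < m ] ∑[ v < n ] δ r v           ≡⟨ ∑-comm δ ⟩
    ∑[ v < n ] ∑[ r < m ] δ r v           ≡⟨ sum-cong-≗ (λ v → sum-δ (f v) (h v)) ⟩
    sum h                                 ∎
    where
    open ≡-Reasoning
    δ : Fin m → Fin n → ℕ
    δ r v = if does (f v ≟ r) then h v else 0

  sum-Σᵥ-fibres : ∀ {n m} (f : Fin n → Fin m) (h : Fin n → ℕ) →
                  ∑[ r < m ] Σᵥ (λ v → if lookup (fibre f r) v then h v else 0) ≡ Σᵥ h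
  sum-Σᵥ-fibres {n} {m} f h = begin
    ∑[ r < m ] Σᵥ (λ v → if lookup (fibre f r) v then h v else 0)  ≡⟨ sum-cong-≗ (λ r → Σᵥ≡sumOn (fibre f r) h) ⟩
    ∑[ r < m ] sumOn (fibre f r) h                                 ≡⟨ sum-sumOn-fibres f h ⟩
    sum h                                                          ≡⟨ Σᵥ≡sum h ⟨
    Σᵥ h                                                           ∎
    where open ≡-Reasoning

  sum-∣fibres∣ : ∀ {n m} (f : Fin n → Fin m) → ∑[ r < m ] ∣ fibre f r ∣ ≡ n
  sum-∣fibres∣ {n} {m} f = begin
    ∑[ r < m ] ∣ fibre f r ∣                ≡⟨ sum-cong-≗ (∣∣≡sumOn ∘ fibre f) ⟩
    ∑[ r < m ] sumOn (fibre f r) (λ _ → 1)  ≡⟨ sum-sumOn-fibres f (λ _ → 1) ⟩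
    ∑[ v < n ] 1                            ≡⟨ sum-const n 1 ⟩
    n * 1                                   ≡⟨ *-identityʳ n ⟩
    n                                       ∎
    where open ≡-Reasoning

module ComponentWitness where

  open Components
  open Erasures
  open Fibres
  open import Defs
    using (ErasedAdj; AdjList; IsSimple; Coincides; GenWitness; ReachG; ⊥In; count⊥; Reach; here; step)
  open import Data.Nat using (_≤_; s≤s)
  open import Data.Nat.Properties using (≤-trans; +-mono-≤)
  open import Data.Fin using (Fin)
  open import Data.Fin.Properties using (_≟_)
  open import Data.Fin.Subset using (Subset; _∈_)
  open import Data.Maybe using (just; nothing)
  open import Data.List.Membership.Propositional using () renaming (_∈_ to _∈ˡ_)
  open import Data.Product using (Σ; ∃; _×_; _,_; proj₁; proj₂)
  open import Data.Sum using (inj₁; inj₂)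
  open import Function using (_∘_)
  open import Relation.Nullary using (¬_; yes; no; contradiction)
  open import Relation.Binary.PropositionalEquality

  module _ {n} {G : ErasedAdj n} {H : AdjList n} (simple : IsSimple H) (coincide : Coincides G H)
           (L : ComponentLabelling H) where

    open ComponentLabelling L

    component : Fin n → Subset n
    component = fibre label

    private
      symH : Symmetric H
      symH {u} {v} = proj₂ (proj₂ simple) u v

    module _ {r} (few⊥ : ⊥In G (component r) ≤ 1) where

      private
        sum⊥≤1 : sumOn (component r) (count⊥ ∘ G) ≤ 1
        sum⊥≤1 = subst (_≤ 1) (Σᵥ≡sumOn (component r) (count⊥ ∘ G)) few⊥

      count⊥≤1 : ∀ {u} → label u ≡ r → count⊥ (G u) ≤ 1
      count⊥≤1 u∈C = ≤-trans (term≤sumOn (count⊥ ∘ G) (∈-fibre⁺ label u∈C)) sum⊥≤1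

      erasing-vertex-unique : ∀ {u v} → label u ≡ r → label v ≡ r →
                              1 ≤ count⊥ (G u) → 1 ≤ count⊥ (G v) → u ≡ v
      erasing-vertex-unique {u} {v} u∈C v∈C ⊥∈u ⊥∈v with u ≟ v
      ... | yes u≡v = u≡v
      ... | no  u≢v = contradiction (≤-trans (+-mono-≤ ⊥∈u ⊥∈v) two⊥≤sum) λ { (s≤s ()) }
        where
        two⊥≤sum = ≤-trans (two-terms≤sumOn (count⊥ ∘ G) (∈-fibre⁺ label u∈C) (∈-fibre⁺ label v∈C) u≢v) sum⊥≤1

      -- The erasure u → x of the component: the reverse entry x → u is intact, and u → x is the
      -- only H-edge of the component missing from G.
      module ErasedEntry {u x} (u∈C : label u ≡ r) (u⊥x : ErasedOver (G u) (H u) x) where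

        x∈Hu : x ∈ˡ H u
        x∈Hu = erased⇒∈ u⊥x

        x∈C : label x ≡ r
        x∈C = trans (sym (label-edge x∈Hu)) u∈C

        u∈Gx : just u ∈ˡ G x
        u∈Gx with ∈⇒just∈⊎erased (coincide x) (symH x∈Hu)
        ... | inj₁ u∈Gx = u∈Gx
        ... | inj₂ x⊥u  = contradiction x∈Hu (subst (λ v → ¬ v ∈ˡ H u) u≡x (proj₁ (proj₂ simple) u))
          where u≡x = erasing-vertex-unique u∈C x∈C (erased⇒count⊥ u⊥x) (erased⇒count⊥ x⊥u)

        x∉Gu : ¬ just x ∈ˡ G u
        x∉Gu = erased⇒just∉ (coincide u) (proj₁ simple u) u⊥x

        -- An erased step a → b of an H-path from x starts at a = u, so b = x.
        nonerased-path : ∀ {w} → Reach (Edge H) x w → ReachG G x w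
        nonerased-path here = here
        nonerased-path (step {a} {b} path b∈Ha) with ∈⇒just∈⊎erased (coincide a) b∈Ha
        ... | inj₁ b∈Ga = step (nonerased-path path) b∈Ga
        ... | inj₂ a⊥b  = subst (ReachG G x) x≡b here
          where
          a≡u = erasing-vertex-unique (trans (sym (label-reach path)) x∈C) u∈C
                                      (erased⇒count⊥ a⊥b) (erased⇒count⊥ u⊥x)
          x≡b = erased-unique (count⊥≤1 u∈C) u⊥x (subst (λ v → ErasedOver (G v) (H v) b) a≡u a⊥b)

    component-witness : ∀ {r} → label r ≡ r → (∃ λ v → ¬ label v ≡ r) → ⊥In G (component r) ≤ 1 →
                        GenWitness G (component r)
    component-witness {r} r-rep (v , v∉C) few⊥ = record
      { nonempty      = r , ∈-fibre⁺ label r-rep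
      ; proper        = v , v∉C ∘ ∈-fibre⁻ label
      ; at-most-one-⊥ = few⊥
      ; closed        = λ v w v∈C w∈Gv →
          ∈-fibre⁺ label (trans (sym (label-edge (just∈⇒∈ (coincide v) w∈Gv))) (∈-fibre⁻ label v∈C))
      ; erased        = erased
      }
      where
      erased : ∀ u → u ∈ component r → nothing ∈ˡ G u →
               Σ (Fin n) λ v → v ∈ component r × just u ∈ˡ G v × ¬ just v ∈ˡ G u ×
                 (∀ w → w ∈ component r → ReachG G v w)
      erased u u∈C ⊥∈Gu with nothing∈⇒erased (coincide u) ⊥∈Gu
      ... | x , u⊥x = x , ∈-fibre⁺ label x∈C , u∈Gx , x∉Gu , λ w w∈C →
                      nonerased-path (same-label⇒reach symH (trans x∈C (sym (∈-fibre⁻ label w∈C))))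
        where open ErasedEntry few⊥ (∈-fibre⁻ label u∈C) u⊥x

module WitnessFamily where

  open FiniteSum
  open ListProperties
  open Components
  open Connecting
  open Fibres
  open ComponentWitness
  open import Defs using (ErasedAdj; AdjList; IsSimple; Coincides; GenWitness; ⊥In; count⊥; total⊥)
  open import Data.Nat using (ℕ; zero; suc; _+_; _*_; _≤_; _≤?_; z≤n)
  open import Data.Nat.Properties
    using (≤-reflexive; ≤-trans; n≤1+n; m≤m+n; m≤n+m; *-monoʳ-≤; ≰⇒>; module ≤-Reasoning)
  open import Data.Fin using (Fin; zero; suc)
  open import Data.Fin.Properties using (any?)
  open import Data.Fin.Subset using (Subset; _∈_)
  open import Data.Bool using (true; false; not; _∧_)
  open import Data.List using (List; []; map; filter; allFin; length)
  open import Data.List.Properties using (length-map)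
  open import Data.List.Relation.Unary.All as All using (All; [])
  import Data.List.Relation.Unary.All.Properties as Allₚ
  open import Data.List.Relation.Unary.AllPairs using ([])
  open import Data.List.Relation.Unary.Unique.Propositional using (Unique)
  import Data.List.Relation.Unary.Unique.Propositional.Properties as Unique
  open import Data.Product using (Σ; ∃; _×_; _,_)
  open import Function using (_∘_)
  open import Relation.Nullary using (¬_; Dec; yes; no; does; contradiction; _×-dec_)
  open import Relation.Nullary.Decidable using (dec-true; dec-false)
  open import Relation.Unary using (Decidable)
  open import Relation.Binary.PropositionalEquality

  -- A representative is a good witness, or carries at least two erasures, or fails P.
  representative-accounted : ∀ rep p k (few? : Dec (k ≤ 1)) →
    4 * indicator rep ≤ 4 * indicator (rep ∧ does few? ∧ p) + 2 * k + 4 * indicator (not p)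
  representative-accounted false p     k few?     = z≤n
  representative-accounted true  true  k (yes _)  = ≤-trans (m≤m+n 4 (2 * k)) (m≤m+n _ 0)
  representative-accounted true  false k (yes _)  = m≤n+m 4 _
  representative-accounted true  p     k (no k≰1) =
    ≤-trans (*-monoʳ-≤ 2 (≰⇒> k≰1)) (≤-trans (m≤n+m (2 * k) (4 * 0)) (m≤m+n _ (4 * indicator (not p))))

  module Family {n} {G : ErasedAdj (suc n)} {H : AdjList (suc n)} (simple : IsSimple H) (coincide : Coincides G H)
                {P : Subset (suc n) → Set} (P? : Decidable P) where

    open StarCompletion H simple

    C : Fin (suc n) → Subset (suc n)
    C = component simple coincide (componentLabelling H symH)

    Good : Fin (suc n) → Set
    Good r = IsRep r × ⊥In G (C r) ≤ 1 × P (C r)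

    good? : Decidable Good
    good? r = isRep? r ×-dec ⊥In G (C r) ≤? 1 ×-dec P? (C r)

    goodReps : List (Fin (suc n))
    goodReps = filter good? (allFin (suc n))

    failures : ℕ
    failures = ∑[ r < suc n ] indicator (not (does (P? (C r))))

    counting : 4 * otherComponents ≤ 4 * length goodReps + 2 * total⊥ G + 4 * failures
    counting = begin
      4 * otherComponents                                            ≤⟨ *-monoʳ-≤ 4 (n≤1+n _) ⟩
      4 * suc otherComponents                                        ≡⟨ cong (4 *_) representatives ⟨
      4 * ∑[ r < suc n ] rep r                                       ≡⟨ *-distribˡ-sum 4 rep ⟩
      ∑[ r < suc n ] (4 * rep r)                                     ≤⟨ sum-mono-≤ accounted ⟩
      ∑[ r < suc n ] (4 * good r + 2 * ⊥In G (C r) + 4 * fail r)     ≡⟨ distribute ⟩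
      4 * ∑[ r < suc n ] good r + 2 * ∑[ r < suc n ] ⊥In G (C r) + 4 * failures
                                                                     ≡⟨ cong₂ (λ x y → 4 * x + 2 * y + 4 * failures)
                                                                              (sym length-goodReps) sum-⊥In ⟩
      4 * length goodReps + 2 * total⊥ G + 4 * failures              ∎
      where
      open ≤-Reasoning
      rep good fail : Fin (suc n) → ℕ
      rep  r = indicator (does (isRep? r))
      good r = indicator (does (good? r))
      fail r = indicator (not (does (P? (C r))))

      representatives : ∑[ r < suc n ] rep r ≡ suc otherComponents
      representatives = cong (λ b → indicator b + otherComponents) (dec-true (isRep? zero) zero-isRep)

      accounted : ∀ r → 4 * rep r ≤ 4 * good r + 2 * ⊥In G (C r) + 4 * fail r
      accounted r = representative-accounted (does (isRep? r)) (does (P? (C r))) (⊥In G (C r)) (⊥In G (C r) ≤? 1)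

      distribute : ∑[ r < suc n ] (4 * good r + 2 * ⊥In G (C r) + 4 * fail r)
                 ≡ 4 * ∑[ r < suc n ] good r + 2 * ∑[ r < suc n ] ⊥In G (C r) + 4 * failures
      distribute = begin-equality
        ∑[ r < suc n ] (4 * good r + 2 * ⊥In G (C r) + 4 * fail r)
          ≡⟨ ∑-distrib-+ (λ r → 4 * good r + 2 * ⊥In G (C r)) (λ r → 4 * fail r) ⟩
        ∑[ r < suc n ] (4 * good r + 2 * ⊥In G (C r)) + ∑[ r < suc n ] (4 * fail r)
          ≡⟨ cong (_+ ∑[ r < suc n ] (4 * fail r)) (∑-distrib-+ (λ r → 4 * good r) (λ r → 2 * ⊥In G (C r))) ⟩
        ∑[ r < suc n ] (4 * good r) + ∑[ r < suc n ] (2 * ⊥In G (C r)) + ∑[ r < suc n ] (4 * fail r)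
          ≡⟨ cong₂ _+_ (cong₂ _+_ (*-distribˡ-sum 4 good) (*-distribˡ-sum 2 (⊥In G ∘ C)))
                   (*-distribˡ-sum 4 fail) ⟨
        4 * ∑[ r < suc n ] good r + 2 * ∑[ r < suc n ] ⊥In G (C r) + 4 * failures ∎

      length-goodReps : length goodReps ≡ ∑[ r < suc n ] good r
      length-goodReps = trans (length-filter≡sum good? (allFin (suc n))) (Σᵥ≡sum good)

      sum-⊥In : ∑[ r < suc n ] ⊥In G (C r) ≡ total⊥ G
      sum-⊥In = sum-Σᵥ-fibres label (count⊥ ∘ G)

    good-component-injective : ∀ {r r′} → Good r → C r ≡ C r′ → r ≡ r′
    good-component-injective {r} (r-rep , _) Cr≡Cr′ =
      trans (sym r-rep) (∈-fibre⁻ label (subst (r ∈_) Cr≡Cr′ (∈-fibre⁺ label r-rep)))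

    outside : ∀ {i} → IsRep (suc i) → ∀ r → ∃ λ v → ¬ label v ≡ r
    outside {i} rep zero    = suc i , λ label≡0 → contradiction (trans (sym label≡0) rep) λ ()
    outside     rep (suc j) = zero  , λ label≡suc → contradiction (trans (sym zero-isRep) label≡suc) λ ()

    witness-family : Σ (List (Subset (suc n))) λ Ws → Unique Ws × All (λ W → GenWitness G W × P W) Ws ×
                     4 * otherComponents ≤ 4 * length Ws + 2 * total⊥ G + 4 * failures
    witness-family with any? (λ i → isRep? (suc i))
    ... | no  one-component = [] , [] , [] , ≤-trans (≤-reflexive (cong (4 *_) no-others)) z≤n
      where
      no-others : otherComponents ≡ 0
      no-others = sum-zero _ λ i → cong indicator (dec-false (isRep? (suc i)) (one-component ∘ (i ,_)))
    ... | yes (i , rep) = map C goodReps , distinct , witnesses ,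
                          subst (λ k → 4 * otherComponents ≤ 4 * k + 2 * total⊥ G + 4 * failures)
                                (sym (length-map C goodReps)) counting
      where
      distinct : Unique (map C goodReps)
      distinct = Unique-map⁺-on C good-component-injective (Allₚ.all-filter good? _)
                                (Unique.filter⁺ good? (Unique.allFin⁺ _))
      witnesses : All (λ W → GenWitness G W × P W) (map C goodReps)
      witnesses = Allₚ.map⁺ (All.map (λ { {r} (r-rep , few⊥ , p) →
                    component-witness simple coincide (componentLabelling H symH) r-rep (outside rep r) few⊥ , p })
                  (Allₚ.all-filter good? _))

module RationalArithmetic where

  open FiniteSum using (sum)
  open import Defs using (ℕtoℚ)
  open import Data.Nat as ℕ using (ℕ; zero; suc)
  import Data.Nat.Properties as ℕ
  open import Data.Integer as ℤ using (+_)
  import Data.Integer.Properties as ℤ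
  open import Data.Integer.Solver using (module +-*-Solver)
  open import Data.Rational using (ℚ; _/_; _≤_; _+_; _*_; _-_; -_; 0ℚ; toℚᵘ; nonNegative)
  open import Data.Rational.Properties
    using (toℚᵘ-fromℚᵘ; toℚᵘ-injective; toℚᵘ-homo-+; toℚᵘ-homo-*; nonNegative⁻¹; normalize-nonNeg;
           ≤-reflexive; +-assoc; +-identityʳ; +-inverseʳ; *-zeroˡ; *-distribʳ-+;
           +-mono-≤; +-monoˡ-≤; +-monoʳ-≤; *-monoˡ-≤-nonNeg; *-monoʳ-≤-nonNeg; module ≤-Reasoning)
  open import Data.Rational.Solver renaming (module +-*-Solver to ℚ-Solver)
  open import Data.Rational.Unnormalised as ℚᵘ using (mkℚᵘ; *≡*)
  import Data.Rational.Unnormalised.Properties as ℚᵘ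
  open import Data.Fin using (Fin; zero; suc)
  open import Function using (_∘_)
  open import Relation.Binary.PropositionalEquality

  ½ : ℚ
  ½ = + 1 / 2

  private
    toℚᵘ-ℕtoℚ : ∀ k → toℚᵘ (ℕtoℚ k) ℚᵘ.≃ mkℚᵘ (+ k) 0
    toℚᵘ-ℕtoℚ k = toℚᵘ-fromℚᵘ (mkℚᵘ (+ k) 0)

    toℚᵘ-/suc : ∀ m k → toℚᵘ (+ m / suc k) ℚᵘ.≃ mkℚᵘ (+ m) k
    toℚᵘ-/suc m k = toℚᵘ-fromℚᵘ (mkℚᵘ (+ m) k)

  ℕtoℚ-+ : ∀ a b → ℕtoℚ (a ℕ.+ b) ≡ ℕtoℚ a + ℕtoℚ b
  ℕtoℚ-+ a b = toℚᵘ-injective (begin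
    toℚᵘ (ℕtoℚ (a ℕ.+ b))              ≈⟨ toℚᵘ-ℕtoℚ (a ℕ.+ b) ⟩
    mkℚᵘ (+ (a ℕ.+ b)) 0               ≈⟨ *≡* (cong (ℤ._* + 1) numerators) ⟩
    mkℚᵘ (+ a) 0 ℚᵘ.+ mkℚᵘ (+ b) 0     ≈⟨ ℚᵘ.+-cong (toℚᵘ-ℕtoℚ a) (toℚᵘ-ℕtoℚ b) ⟨
    toℚᵘ (ℕtoℚ a) ℚᵘ.+ toℚᵘ (ℕtoℚ b)   ≈⟨ toℚᵘ-homo-+ (ℕtoℚ a) (ℕtoℚ b) ⟨
    toℚᵘ (ℕtoℚ a + ℕtoℚ b)             ∎)
    where
    open ℚᵘ.≃-Reasoning
    numerators : + (a ℕ.+ b) ≡ + a ℤ.* + 1 ℤ.+ + b ℤ.* + 1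
    numerators = trans (ℤ.pos-+ a b) (sym (cong₂ ℤ._+_ (ℤ.*-identityʳ (+ a)) (ℤ.*-identityʳ (+ b))))

  ℕtoℚ-* : ∀ a b → ℕtoℚ (a ℕ.* b) ≡ ℕtoℚ a * ℕtoℚ b
  ℕtoℚ-* a b = toℚᵘ-injective (begin
    toℚᵘ (ℕtoℚ (a ℕ.* b))              ≈⟨ toℚᵘ-ℕtoℚ (a ℕ.* b) ⟩
    mkℚᵘ (+ (a ℕ.* b)) 0               ≈⟨ *≡* (cong (ℤ._* + 1) (ℤ.pos-* a b)) ⟩
    mkℚᵘ (+ a) 0 ℚᵘ.* mkℚᵘ (+ b) 0     ≈⟨ ℚᵘ.*-cong (toℚᵘ-ℕtoℚ a) (toℚᵘ-ℕtoℚ b) ⟨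
    toℚᵘ (ℕtoℚ a) ℚᵘ.* toℚᵘ (ℕtoℚ b)   ≈⟨ toℚᵘ-homo-* (ℕtoℚ a) (ℕtoℚ b) ⟨
    toℚᵘ (ℕtoℚ a * ℕtoℚ b)             ∎)
    where open ℚᵘ.≃-Reasoning

  ℕtoℚ-*-/suc : ∀ m k → ℕtoℚ (suc k) * (+ m / suc k) ≡ ℕtoℚ m
  ℕtoℚ-*-/suc m k = toℚᵘ-injective (begin
    toℚᵘ (ℕtoℚ (suc k) * (+ m / suc k))          ≈⟨ toℚᵘ-homo-* (ℕtoℚ (suc k)) (+ m / suc k) ⟩
    toℚᵘ (ℕtoℚ (suc k)) ℚᵘ.* toℚᵘ (+ m / suc k)  ≈⟨ ℚᵘ.*-cong (toℚᵘ-ℕtoℚ (suc k)) (toℚᵘ-/suc m k) ⟩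
    mkℚᵘ (+ suc k) 0 ℚᵘ.* mkℚᵘ (+ m) k           ≈⟨ *≡* cross-multiplied ⟩
    mkℚᵘ (+ m) 0                                 ≈⟨ toℚᵘ-ℕtoℚ m ⟨
    toℚᵘ (ℕtoℚ m)                                ∎)
    where
    open ℚᵘ.≃-Reasoning
    open +-*-Solver
    cross-multiplied : (+ suc k ℤ.* + m) ℤ.* + 1 ≡ + m ℤ.* + suc (k ℕ.+ 0)
    cross-multiplied = trans (solve 2 (λ x y → (x :* y) :* con (+ 1) := y :* x) refl (+ suc k) (+ m))
                             (cong (λ j → + m ℤ.* + suc j) (sym (ℕ.+-identityʳ k)))

  ℕtoℚ-nonNeg : ∀ k → 0ℚ ≤ ℕtoℚ k
  ℕtoℚ-nonNeg k = nonNegative⁻¹ (ℕtoℚ k) {{normalize-nonNeg k 1}}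

  ℕtoℚ-mono-≤ : ∀ {a b} → a ℕ.≤ b → ℕtoℚ a ≤ ℕtoℚ b
  ℕtoℚ-mono-≤ {a} {b} a≤b = begin
    ℕtoℚ a                    ≡⟨ +-identityʳ (ℕtoℚ a) ⟨
    ℕtoℚ a + 0ℚ               ≤⟨ +-monoʳ-≤ (ℕtoℚ a) (ℕtoℚ-nonNeg (b ℕ.∸ a)) ⟩
    ℕtoℚ a + ℕtoℚ (b ℕ.∸ a)   ≡⟨ ℕtoℚ-+ a (b ℕ.∸ a) ⟨
    ℕtoℚ (a ℕ.+ (b ℕ.∸ a))    ≡⟨ cong ℕtoℚ (ℕ.m+[n∸m]≡n a≤b) ⟩
    ℕtoℚ b                    ∎
    where open ≤-Reasoning

  *-nonNeg : ∀ {p q} → 0ℚ ≤ p → 0ℚ ≤ q → 0ℚ ≤ p * q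
  *-nonNeg {p} {q} p≥0 q≥0 = subst (_≤ p * q) (*-zeroˡ q) (*-monoʳ-≤-nonNeg q {{nonNegative q≥0}} p≥0)

  p≤q⇒0≤q-p : ∀ {p q} → p ≤ q → 0ℚ ≤ q - p
  p≤q⇒0≤q-p {p} {q} p≤q = subst (_≤ q - p) (+-inverseʳ p) (+-monoˡ-≤ (- p) p≤q)

  ℕtoℚ-sum-≤-scaled : ∀ {n} (f w : Fin n → ℕ) (κ : ℚ) → (∀ i → ℕtoℚ (f i) ≤ ℕtoℚ (w i) * κ) →
                      ℕtoℚ (sum f) ≤ ℕtoℚ (sum w) * κ
  ℕtoℚ-sum-≤-scaled {zero}  f w κ f≤wκ = ≤-reflexive (sym (*-zeroˡ κ))
  ℕtoℚ-sum-≤-scaled {suc n} f w κ f≤wκ = begin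
    ℕtoℚ (f zero ℕ.+ sum (f ∘ suc))               ≡⟨ ℕtoℚ-+ (f zero) (sum (f ∘ suc)) ⟩
    ℕtoℚ (f zero) + ℕtoℚ (sum (f ∘ suc))          ≤⟨ +-mono-≤ (f≤wκ zero)
                                                       (ℕtoℚ-sum-≤-scaled (f ∘ suc) (w ∘ suc) κ (f≤wκ ∘ suc)) ⟩
    ℕtoℚ (w zero) * κ + ℕtoℚ (sum (w ∘ suc)) * κ  ≡⟨ *-distribʳ-+ κ (ℕtoℚ (w zero)) (ℕtoℚ (sum (w ∘ suc))) ⟨
    (ℕtoℚ (w zero) + ℕtoℚ (sum (w ∘ suc))) * κ    ≡⟨ cong (_* κ) (ℕtoℚ-+ (w zero) (sum (w ∘ suc))) ⟨
    ℕtoℚ (w zero ℕ.+ sum (w ∘ suc)) * κ           ∎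
    where open ≤-Reasoning

  /2≡*½ : ∀ m → + m / 2 ≡ ℕtoℚ m * ½
  /2≡*½ m = begin
    + m / 2                  ≡⟨ solve 1 (λ x → x := con (ℕtoℚ 2) :* x :* con ½) refl (+ m / 2) ⟩
    ℕtoℚ 2 * (+ m / 2) * ½   ≡⟨ cong (_* ½) (ℕtoℚ-*-/suc m 1) ⟩
    ℕtoℚ m * ½               ∎
    where
    open ≡-Reasoning
    open ℚ-Solver

  -- With t = 2m: ε m is at most the number ρ of components beyond the first, and all of the
  -- ρ + 1 components except the w good ones are paid for, two each, by the b ≤ α t erasures
  -- or, four each, by f ≤ (ε − α) t.
  good-count-bound : ∀ (ε α t : ℚ) (ρ w b f : ℕ) →
    ε * (t * ½) ≤ ℕtoℚ ρ → 4 ℕ.* ρ ℕ.≤ 4 ℕ.* w ℕ.+ 2 ℕ.* b ℕ.+ f →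
    ℕtoℚ b ≤ α * t → ℕtoℚ f ≤ (ε - α) * t →
    (ε - α) * (t * ½) * ½ ≤ ℕtoℚ w
  good-count-bound ε α t ρ w b f εm≤ρ counted b≤αt f≤εt = begin
    (ε - α) * (t * ½) * ½                 ≡⟨ solve 3 (λ ε α t → (ε :- α) :* (t :* con ½) :* con ½
                                                := con ¼ :* (con (ℕtoℚ 4) :* (ε :* (t :* con ½))
                                                             :- (con (ℕtoℚ 2) :* (α :* t) :+ (ε :- α) :* t)))
                                               refl ε α t ⟩
    ¼ * (ℕtoℚ 4 * (ε * (t * ½)) - Z)      ≤⟨ ¼[-Z]-mono (*-monoˡ-≤-nonNeg (ℕtoℚ 4) εm≤ρ) ⟩
    ¼ * (ℕtoℚ 4 * ρ′ - Z)                 ≤⟨ ¼[-Z]-mono counted′ ⟩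
    ¼ * (ℕtoℚ 4 * w′ + ℕtoℚ 2 * b′ + f′ - Z) ≤⟨ ¼[-Z]-mono budgets ⟩
    ¼ * (ℕtoℚ 4 * w′ + Z - Z)             ≡⟨ solve 2 (λ w z → con ¼ :* (con (ℕtoℚ 4) :* w :+ z :- z) := w)
                                               refl w′ Z ⟩
    w′                                    ∎
    where
    open ≤-Reasoning
    open ℚ-Solver
    ρ′ w′ b′ f′ ¼ Z : ℚ
    ρ′ = ℕtoℚ ρ
    w′ = ℕtoℚ w
    b′ = ℕtoℚ b
    f′ = ℕtoℚ f
    ¼  = + 1 / 4
    Z  = ℕtoℚ 2 * (α * t) + (ε - α) * t
    ¼[-Z]-mono : ∀ {x y} → x ≤ y → ¼ * (x - Z) ≤ ¼ * (y - Z)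
    ¼[-Z]-mono x≤y = *-monoˡ-≤-nonNeg ¼ (+-monoˡ-≤ (- Z) x≤y)
    counted′ : ℕtoℚ 4 * ρ′ ≤ ℕtoℚ 4 * w′ + ℕtoℚ 2 * b′ + f′
    counted′ = subst₂ _≤_ (ℕtoℚ-* 4 ρ)
      (trans (ℕtoℚ-+ (4 ℕ.* w ℕ.+ 2 ℕ.* b) f)
             (cong (_+ f′) (trans (ℕtoℚ-+ (4 ℕ.* w) (2 ℕ.* b)) (cong₂ _+_ (ℕtoℚ-* 4 w) (ℕtoℚ-* 2 b)))))
      (ℕtoℚ-mono-≤ counted)
    budgets : ℕtoℚ 4 * w′ + ℕtoℚ 2 * b′ + f′ ≤ ℕtoℚ 4 * w′ + Z
    budgets = subst (ℕtoℚ 4 * w′ + ℕtoℚ 2 * b′ + f′ ≤_) (+-assoc (ℕtoℚ 4 * w′) _ _)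
      (+-mono-≤ (+-monoʳ-≤ (ℕtoℚ 4 * w′) (*-monoˡ-≤-nonNeg (ℕtoℚ 2) b≤αt)) f≤εt)

module Smallness where

  open FiniteSum
  open Fibres
  open RationalArithmetic
  open import Defs using (ErasedAdj; IsSmall; avgDeg; totalLen; repLen; ℕtoℚ)
  open import Data.Nat as ℕ using (ℕ; suc)
  open import Data.Fin using (Fin)
  open import Data.Fin.Subset using (∣_∣)
  open import Data.Bool using (not)
  open import Data.List using (length)
  open import Data.Rational using (ℚ; _≤_; _*_; 0ℚ)
  open import Data.Rational.Properties
    using (_≤?_; _<?_; <⇒≤; ≰⇒>; *-assoc; *-comm; nonNegative⁻¹; normalize-nonNeg; module ≤-Reasoning)
  open import Data.Product using (_,_)
  open import Data.Sum using (inj₁; inj₂)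
  open import Function using (_∘_)
  open import Relation.Nullary using (¬_; Dec; yes; no; does; contradiction; _×-dec_; _⊎-dec_)
  open import Relation.Binary.PropositionalEquality

  -- Opaque, so that comparing types never evaluates the rational comparisons.
  opaque
    isSmall? : ∀ {n} ε* (G : ErasedAdj n) C → Dec (IsSmall ε* G C)
    isSmall? ε* G C = (ℕtoℚ 4 ≤? ε* * d * d ×-dec ℕtoℚ ∣ C ∣ * ε* * d ≤? ℕtoℚ 4)
                      ⊎-dec (ε* * d * d <? ℕtoℚ 4 ×-dec ℕtoℚ (repLen G C) * ε* ≤? ℕtoℚ 4)
      where
      d : ℚ
      d = avgDeg G

  module _ {n m} (ε* : ℚ) (G : ErasedAdj (suc n)) (f : Fin (suc n) → Fin m) where

    large : Fin m → ℕ
    large r = indicator (not (does (isSmall? ε* G (fibre f r))))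

    private
      d t : ℚ
      d = avgDeg G
      t = ℕtoℚ (totalLen G)

      d-nonNeg : 0ℚ ≤ d
      d-nonNeg = nonNegative⁻¹ d {{normalize-nonNeg (totalLen G) (suc n)}}

      large-≤-weight : ∀ (w : Fin m → ℕ) {κ} → 0ℚ ≤ κ →
                       (∀ r → ¬ IsSmall ε* G (fibre f r) → ℕtoℚ 4 ≤ ℕtoℚ (w r) * κ) →
                       ℕtoℚ (4 ℕ.* sum large) ≤ ℕtoℚ (sum w) * κ
      large-≤-weight w {κ} κ≥0 large⇒ =
        subst (_≤ ℕtoℚ (sum w) * κ) (cong ℕtoℚ (sym (*-distribˡ-sum 4 large)))
              (ℕtoℚ-sum-≤-scaled (λ r → 4 ℕ.* large r) w κ λ r → termwise r (isSmall? ε* G (fibre f r)))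
        where
        termwise : ∀ r (small? : Dec (IsSmall ε* G (fibre f r))) →
                   ℕtoℚ (4 ℕ.* indicator (not (does small?))) ≤ ℕtoℚ (w r) * κ
        termwise r (yes _)       = *-nonNeg (ℕtoℚ-nonNeg (w r)) κ≥0
        termwise r (no  ¬small) = large⇒ r ¬small

    module _ (ε*≥0 : 0ℚ ≤ ε*) where

      dense-budget : ℕtoℚ 4 ≤ ε* * d * d → ℕtoℚ (4 ℕ.* sum large) ≤ ε* * t
      dense-budget dense = begin
        ℕtoℚ (4 ℕ.* sum large)
          ≤⟨ large-≤-weight (λ r → ∣ fibre f r ∣) (*-nonNeg ε*≥0 d-nonNeg)
                            (λ r → large⇒ r (ℕtoℚ ∣ fibre f r ∣ * ε* * d ≤? ℕtoℚ 4)) ⟩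
        ℕtoℚ (∑[ r < m ] ∣ fibre f r ∣) * (ε* * d)   ≡⟨ cong (λ k → ℕtoℚ k * (ε* * d)) (sum-∣fibres∣ f) ⟩
        ℕtoℚ (suc n) * (ε* * d)                       ≡⟨ *-assoc (ℕtoℚ (suc n)) ε* d ⟨
        ℕtoℚ (suc n) * ε* * d                         ≡⟨ cong (_* d) (*-comm (ℕtoℚ (suc n)) ε*) ⟩
        ε* * ℕtoℚ (suc n) * d                         ≡⟨ *-assoc ε* (ℕtoℚ (suc n)) d ⟩
        ε* * (ℕtoℚ (suc n) * d)                       ≡⟨ cong (ε* *_) (ℕtoℚ-*-/suc (totalLen G) n) ⟩
        ε* * t                                        ∎
        where
        open ≤-Reasoning
        large⇒ : ∀ r → Dec (ℕtoℚ ∣ fibre f r ∣ * ε* * d ≤ ℕtoℚ 4) →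
                 ¬ IsSmall ε* G (fibre f r) → ℕtoℚ 4 ≤ ℕtoℚ ∣ fibre f r ∣ * (ε* * d)
        large⇒ r (yes small) ¬small = contradiction (inj₁ (dense , small)) ¬small
        large⇒ r (no  big)   _      = subst (ℕtoℚ 4 ≤_) (*-assoc (ℕtoℚ ∣ fibre f r ∣) ε* d) (<⇒≤ (≰⇒> big))

      sparse-budget : ¬ ℕtoℚ 4 ≤ ε* * d * d → ℕtoℚ (4 ℕ.* sum large) ≤ ε* * t
      sparse-budget sparse = begin
        ℕtoℚ (4 ℕ.* sum large)
          ≤⟨ large-≤-weight (λ r → repLen G (fibre f r)) ε*≥0
                            (λ r → large⇒ r (ℕtoℚ (repLen G (fibre f r)) * ε* ≤? ℕtoℚ 4)) ⟩
        ℕtoℚ (∑[ r < m ] repLen G (fibre f r)) * ε*  ≡⟨ cong (λ k → ℕtoℚ k * ε*) (sum-Σᵥ-fibres f (length ∘ G)) ⟩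
        t * ε*                                        ≡⟨ *-comm t ε* ⟩
        ε* * t                                        ∎
        where
        open ≤-Reasoning
        large⇒ : ∀ r → Dec (ℕtoℚ (repLen G (fibre f r)) * ε* ≤ ℕtoℚ 4) →
                 ¬ IsSmall ε* G (fibre f r) → ℕtoℚ 4 ≤ ℕtoℚ (repLen G (fibre f r)) * ε*
        large⇒ r (yes small) ¬small = contradiction (inj₂ (≰⇒> sparse , small)) ¬small
        large⇒ r (no  big)   _      = <⇒≤ (≰⇒> big)

      large-budget : ℕtoℚ (4 ℕ.* sum large) ≤ ε* * t
      large-budget = by-density (ℕtoℚ 4 ≤? ε* * d * d)
        where
        by-density : Dec (ℕtoℚ 4 ≤ ε* * d * d) → ℕtoℚ (4 ℕ.* sum large) ≤ ε* * t
        by-density (yes dense)  = dense-budget dense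
        by-density (no  sparse) = sparse-budget sparse

open import Defs
open import Data.Nat as ℕ using (ℕ; zero; suc)
open import Data.Integer using (+_)
open import Data.Rational using (ℚ; _/_; _≤_; _<_; _*_; _-_; 0ℚ; 1ℚ)
open import Data.Rational.Properties using (≤-reflexive; ≤-trans; *-zeroˡ; *-zeroʳ; <⇒≤)
open import Data.Fin.Subset using (Subset)
open import Data.List using (List; []; length)
open import Data.List.Relation.Unary.All using (All; [])
open import Data.List.Relation.Unary.AllPairs using ([])
open import Data.List.Relation.Unary.Unique.Propositional using (Unique)
open import Data.Product using (Σ; _×_; _,_)
open import Relation.Binary.PropositionalEquality using (subst; sym; trans; cong)
open RationalArithmetic
open Smallness using (isSmall?; large-budget)

claim2p4 : (n : ℕ) (G : ErasedAdj n) (α ε : ℚ) →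
    0ℚ ≤ α → α ≤ 1ℚ → IsAlphaErased α G →
    0ℚ < ε → ε * avgDeg G < ℕtoℚ 2 → α < ε →
    IsFarFromConnected ε G →
    Σ (List (Subset n)) λ Ws → Unique Ws ×
      All (λ C → GenWitness G C × IsSmall (ε - α) G C) Ws ×
      ((ε - α) * mOf G * (+ 1 / 2) ≤ ℕtoℚ (length Ws))
claim2p4 zero G α ε _ _ _ _ _ _ _ =
  [] , [] , [] , ≤-reflexive (trans (cong (_* ½) (*-zeroʳ (ε - α))) (*-zeroˡ ½))
claim2p4 (suc n) G α ε _ _ (H , simple , coincide , few-erasures) _ _ α<ε far =
  let Ws , distinct , witnesses , counted = witness-family in
  Ws , distinct , witnesses ,
  subst (λ m → (ε - α) * m * ½ ≤ ℕtoℚ (length Ws)) (sym (/2≡*½ (totalLen G)))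
    (good-count-bound ε α (ℕtoℚ (totalLen G)) otherComponents (length Ws) (total⊥ G) (4 ℕ.* failures)
       far-bound counted few-erasures (large-budget (ε - α) G label (p≤q⇒0≤q-p (<⇒≤ α<ε))))
  where
  open Connecting.StarCompletion H simple
  open WitnessFamily.Family simple coincide (isSmall? (ε - α) G) using (witness-family; failures)
  far-bound : ε * (ℕtoℚ (totalLen G) * ½) ≤ ℕtoℚ otherComponents
  far-bound = subst (λ m → ε * m ≤ ℕtoℚ otherComponents) (/2≡*½ (totalLen G))
    (≤-trans (far H K (simple , coincide) K-connected) (ℕtoℚ-mono-≤ edgeDiff≤otherComponents))
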